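{- Let $d$ be a positive integer. For all $(x_1,x_2,\ldots,x_d)\in\mathbb{N}^d$, $r_d^{ -1}(r_d(x_1,x_2,\ldots,x_d))=(x_1,x_2,\ldots,x_d)$, where $r_d^{ -1}$ is the recursive formula given in the context.
   Context: $\mathbb{N}$ denotes the set of non-negative integers. The Rosenberg-Strong $d$-tupling function $r_d\colon\mathbb{N}^d\to\mathbb{N}$ is defined by $r_1(x_1)=x_1$ and, for $d>1$, $r_d(x_1,\ldots,x_{d-1},x_d)=r_{d-1}(x_1,\ldots,x_{d-1})+m^d+(m-x_d)\bigl((m+1)^{d-1}-m^{d-1}\bigr)$ with $m=\max(x_1,\ldots,x_d)$. The formula $r_d^{ -1}$ is defined recursively by $r_1^{ -1}(z)=z$ and, for integers $d>1$, $r_d^{ -1}(z)=\Bigl(r_{d-1}^{ -1}\bigl(z-m^d-(m-x_d)((m+1)^{d-1}-m^{d-1})\bigr),\,x_d\Bigr)$, where $m=\lfloor\sqrt[d]{z}\rfloor$ and $x_d=m-\left\lfloor\frac{\max(0,\,z-m^d-m^{d-1})}{(m+1)^{d-1}-m^{d-1}}\right\rfloor$; here $(\mathbf{v},x_d)$ with $\mathbf{v}=(v_1,\ldots,v_{d-1})$ denotes $(v_1,\ldots,v_{d-1},x_d)$. -}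

module Defs where

open import Data.Nat using (ℕ; zero; suc; _+_; _*_; _∸_; _^_; _⊔_; _≤ᵇ_)
open import Data.Nat.DivMod using (_/_)
open import Data.Bool using (if_then_else_)
open import Data.Vec using (Vec; []; _∷_; _∷ʳ_; init; last; foldr)

-- Tuples (x₁,…,x_d) ∈ ℕ^d are represented as Vec ℕ d; we index by d = suc n
-- so that d ≥ 1 (d is a positive integer).  (v , x_d) is  v ∷ʳ x_d .

maxV : ∀ {k} → Vec ℕ k → ℕ
maxV = foldr _ _⊔_ 0

-- Rosenberg–Strong d-tupling function r_d with d = suc n.
r : (n : ℕ) → Vec ℕ (suc n) → ℕ
r zero    (x ∷ []) = x
r (suc n) xs =
  let m = maxV xs
      d = suc (suc n)
  in r n (init xs) + m ^ d + (m ∸ last xs) * ((suc m) ^ suc n ∸ m ^ suc n)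

rootSearch : (d z b : ℕ) → ℕ
rootSearch d z zero    = zero
rootSearch d z (suc b) = if (suc b) ^ d ≤ᵇ z then suc b else rootSearch d z b

-- floor of the d-th root of z (for d ≥ 1, the root is ≤ z).
iroot : (d z : ℕ) → ℕ
iroot d z = rootSearch d z z

-- natural-number floor division; the divisor 0 case never arises below
-- (for d > 1, (m+1)^(d-1) − m^(d-1) ≥ 1).
divℕ : ℕ → ℕ → ℕ
divℕ a zero    = 0
divℕ a (suc k) = a / suc k

rinv : (n : ℕ) → ℕ → Vec ℕ (suc n)
rinv zero    z = z ∷ []
rinv (suc n) z =
  let d   = suc (suc n)
      m   = iroot d z
      den = (suc m) ^ suc n ∸ m ^ suc n
      xd  = m ∸ divℕ (z ∸ m ^ d ∸ m ^ suc n) den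
  in rinv n (z ∸ m ^ d ∸ (m ∸ xd) * den) ∷ʳ xd

module Submission where

-- Write d = k + 1 and let M be the maximum of a tuple v ∷ʳ x of
-- length d + 1 ≥ 2.  Two facts drive the proof.
--   (1) Range: r encodes a tuple with maximum M into the block
--       M ^ d ≤ r < (M + 1) ^ d; this follows by induction on d from the
--       telescoping identity M ^ k + shell k M = (M + 1) ^ k, where
--       shell k M = (M + 1) ^ k ∸ M ^ k.
--   (2) One decoding step: if z = R + M ^ (k+1) + (M ∸ x) * shell k M with
--       x ≤ M, R < (M + 1) ^ k, and M ^ k ≤ R whenever x < M, then one
--       unfolding of rinv recovers M as the integer root of z, then x as
--       M minus a quotient, and hands the remainder R to the next level.
-- For a tuple v ∷ʳ x, fact (1) for v supplies exactly the hypotheses of (2)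
-- with R = r v (the lower bound is only needed when x < M, in which case M
-- is also the maximum of v), so the theorem follows by induction on d.

open import Defs
open import Data.Nat
  using (ℕ; suc; zero; _+_; _*_; _∸_; _^_; _⊔_; _≤_; _<_; z≤n; s≤s; s≤s⁻¹; _≤ᵇ_)
open import Data.Nat.Properties
open import Data.Nat.DivMod using (_/_; +-distrib-/-∣ʳ; m<n⇒m/n≡0; m*n/n≡m)
open import Data.Nat.Divisibility using (n∣m*n)
open import Data.Vec using (Vec; []; _∷_; _∷ʳ_; initLast)
open import Data.Vec.Properties using (init-∷ʳ; last-∷ʳ)
open import Data.Product using (_,_)
open import Data.Sum using (inj₁; inj₂)
open import Data.Bool using (true; false; T)
open import Data.Empty using (⊥-elim)
open import Relation.Binary.PropositionalEquality

-- shell k m = (m+1)^k − m^k counts the k-tuples whose maximum is exactly m;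
-- it is the denominator in the formula for rinv.
shell : ℕ → ℕ → ℕ
shell k m = suc m ^ k ∸ m ^ k

cube+shell : ∀ k m → m ^ k + shell k m ≡ suc m ^ k
cube+shell k m = m+[n∸m]≡n (^-monoˡ-≤ k (n≤1+n m))

below-next-cube : ∀ k m R c → R < suc m ^ k → c ≤ m * shell k m →
                  R + m ^ suc k + c < suc m ^ suc k
below-next-cube k m R c R<P c≤mD = begin-strict
    R + m * m ^ k + c
  <⟨ +-mono-≤ (+-monoˡ-≤ (m * m ^ k) R<P) c≤mD ⟩
    suc m ^ k + m * m ^ k + m * shell k m
  ≡⟨ +-assoc (suc m ^ k) (m * m ^ k) (m * shell k m) ⟩
    suc m ^ k + (m * m ^ k + m * shell k m)
  ≡⟨ cong (suc m ^ k +_) (sym (*-distribˡ-+ m (m ^ k) (shell k m))) ⟩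
    suc m ^ k + m * (m ^ k + shell k m)
  ≡⟨ cong (λ y → suc m ^ k + m * y) (cube+shell k m) ⟩
    suc m ^ k + m * suc m ^ k
  ∎
  where open ≤-Reasoning

-- A number is at most its positive powers (needed to start the root search).
m≤m^[1+k] : ∀ k m → m ≤ m ^ suc k
m≤m^[1+k] k zero    = z≤n
m≤m^[1+k] k (suc m) = m≤m*n (suc m) (suc m ^ k) {{m^n≢0 (suc m) k}}

rootSearch-finds : ∀ d z m b → m ≤ b → m ^ d ≤ z → z < suc m ^ d →
                   rootSearch d z b ≡ m
rootSearch-finds d z .zero zero z≤n lo hi = refl
rootSearch-finds d z m (suc b) m≤1+b lo hi with m≤n⇒m<n∨m≡n m≤1+b
... | inj₂ refl with suc b ^ d ≤ᵇ z | ≤⇒≤ᵇ {suc b ^ d} {z} lo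
...   | true | _ = refl
rootSearch-finds d z m (suc b) m≤1+b lo hi | inj₁ m<1+b with suc b ^ d ≤ᵇ z in eq
...   | false = rootSearch-finds d z m b (s≤s⁻¹ m<1+b) lo hi
...   | true  = ⊥-elim (<⇒≱ (<-≤-trans hi (^-monoˡ-≤ d m<1+b))
                             (≤ᵇ⇒≤ (suc b ^ d) z (subst T (sym eq) _)))

iroot-correct : ∀ k z m → m ^ suc k ≤ z → z < suc m ^ suc k → iroot (suc k) z ≡ m
iroot-correct k z m lo hi =
  rootSearch-finds (suc k) z m z (≤-trans (m≤m^[1+k] k m) lo) lo hi

divℕ-quotient : ∀ t c D → t < D → divℕ (t + c * D) D ≡ c
divℕ-quotient t c zero    ()
divℕ-quotient t c (suc D) t<D = begin
    (t + c * suc D) / suc D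
  ≡⟨ +-distrib-/-∣ʳ t (n∣m*n c) ⟩
    t / suc D + c * suc D / suc D
  ≡⟨ cong₂ _+_ (m<n⇒m/n≡0 t<D) (m*n/n≡m c (suc D)) ⟩
    c
  ∎
  where open ≡-Reasoning

∸-below : ∀ R P Q → R < P → Q < P → R ∸ Q < P ∸ Q
∸-below R P Q R<P Q<P with ≤-total Q R
... | inj₁ Q≤R = ∸-monoˡ-< R<P Q≤R
... | inj₂ R≤Q = subst (_< P ∸ Q) (sym (m≤n⇒m∸n≡0 R≤Q)) (m<n⇒0<n∸m Q<P)

maxV-∷ʳ : ∀ {k} (v : Vec ℕ k) x → maxV (v ∷ʳ x) ≡ maxV v ⊔ x
maxV-∷ʳ []      x = ⊔-identityʳ x
maxV-∷ʳ (y ∷ v) x = trans (cong (y ⊔_) (maxV-∷ʳ v x)) (sym (⊔-assoc y (maxV v) x))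

maxV-init≤ : ∀ {k} (v : Vec ℕ k) x → maxV v ≤ maxV (v ∷ʳ x)
maxV-init≤ v x = subst (maxV v ≤_) (sym (maxV-∷ʳ v x)) (m≤m⊔n (maxV v) x)

last≤maxV : ∀ {k} (v : Vec ℕ k) x → x ≤ maxV (v ∷ʳ x)
last≤maxV v x = subst (x ≤_) (sym (maxV-∷ʳ v x)) (m≤n⊔m (maxV v) x)

maxV-in-init : ∀ {k} (v : Vec ℕ k) x → x < maxV (v ∷ʳ x) → maxV (v ∷ʳ x) ≡ maxV v
maxV-in-init v x x<M with ≤-total (maxV v) x
... | inj₁ mv≤x = ⊥-elim (<-irrefl (sym (trans (maxV-∷ʳ v x) (m≤n⇒m⊔n≡n mv≤x))) x<M)
... | inj₂ x≤mv = trans (maxV-∷ʳ v x) (m≥n⇒m⊔n≡m x≤mv)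

by-∷ʳ : ∀ {n} (P : Vec ℕ (suc n) → Set) → (∀ v x → P (v ∷ʳ x)) → ∀ xs → P xs
by-∷ʳ P case xs with initLast xs
... | v , x , refl = case v x

r-∷ʳ : ∀ n (v : Vec ℕ (suc n)) x → let M = maxV (v ∷ʳ x) in
       r (suc n) (v ∷ʳ x) ≡ r n v + M ^ suc (suc n) + (M ∸ x) * shell (suc n) M
r-∷ʳ n v x = cong₂ (λ a b → r n a + M ^ suc (suc n) + (M ∸ b) * shell (suc n) M)
                   (init-∷ʳ x v) (last-∷ʳ x v)
  where M = maxV (v ∷ʳ x)

r-upper : ∀ n (xs : Vec ℕ (suc n)) → r n xs < suc (maxV xs) ^ suc n
r-upper zero (x ∷ []) =
  subst (x <_) (sym (trans (*-identityʳ _) (cong suc (⊔-identityʳ x)))) (n<1+n x)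
r-upper (suc n) = by-∷ʳ (λ xs → r (suc n) xs < suc (maxV xs) ^ suc (suc n)) upper
  where
  upper : ∀ v x → r (suc n) (v ∷ʳ x) < suc (maxV (v ∷ʳ x)) ^ suc (suc n)
  upper v x = subst (_< suc M ^ suc (suc n)) (sym (r-∷ʳ n v x))
        (below-next-cube (suc n) M (r n v) _
          (<-≤-trans (r-upper n v) (^-monoˡ-≤ (suc n) (s≤s (maxV-init≤ v x))))
          (*-monoˡ-≤ _ (m∸n≤m M x)))
    where M = maxV (v ∷ʳ x)

r-lower : ∀ n (xs : Vec ℕ (suc n)) → maxV xs ^ suc n ≤ r n xs
r-lower zero (x ∷ []) = ≤-reflexive (trans (*-identityʳ _) (⊔-identityʳ x))
r-lower (suc n) = by-∷ʳ (λ xs → maxV xs ^ suc (suc n) ≤ r (suc n) xs) lower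
  where
  lower : ∀ v x → maxV (v ∷ʳ x) ^ suc (suc n) ≤ r (suc n) (v ∷ʳ x)
  lower v x = subst (maxV (v ∷ʳ x) ^ suc (suc n) ≤_) (sym (r-∷ʳ n v x))
                (≤-trans (m≤n+m _ (r n v)) (m≤m+n _ _))

rinv-unfold : ∀ n z m → iroot (suc (suc n)) z ≡ m →
  rinv (suc n) z ≡
    (let xd = m ∸ divℕ (z ∸ m ^ suc (suc n) ∸ m ^ suc n) (shell (suc n) m)
     in rinv n (z ∸ m ^ suc (suc n) ∸ (m ∸ xd) * shell (suc n) m) ∷ʳ xd)
rinv-unfold n z .(iroot (suc (suc n)) z) refl = refl

decode-step : ∀ n R M x → x ≤ M → R < suc M ^ suc n → (x < M → M ^ suc n ≤ R) →
  rinv (suc n) (R + M ^ suc (suc n) + (M ∸ x) * shell (suc n) M) ≡ rinv n R ∷ʳ x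
decode-step n R M x x≤M R<P x<M⇒Q≤R =
  trans (rinv-unfold n z M root) (cong₂ _∷ʳ_ (cong (rinv n) remainder) last-digit)
  where
    k = suc n
    A = M ^ suc k
    Q = M ^ k
    D = shell k M
    c = (M ∸ x) * D
    z = R + A + c

    root : iroot (suc k) z ≡ M
    root = iroot-correct k z M (≤-trans (m≤n+m A R) (m≤m+n _ c))
             (below-next-cube k M R c R<P (*-monoˡ-≤ D (m∸n≤m M x)))

    minus-cube : z ∸ A ≡ R + c
    minus-cube = begin
        R + A + c ∸ A   ≡⟨ cong (_∸ A) (+-assoc R A c) ⟩
        R + (A + c) ∸ A ≡⟨ cong (λ y → R + y ∸ A) (+-comm A c) ⟩
        R + (c + A) ∸ A ≡⟨ cong (_∸ A) (sym (+-assoc R c A)) ⟩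
        R + c + A ∸ A   ≡⟨ m+n∸n≡m (R + c) A ⟩
        R + c           ∎
      where open ≡-Reasoning

    -- Either c = 0 (x is the maximum) or Q ≤ R, so subtracting Q
    -- only affects R.
    offset : R + c ∸ Q ≡ (R ∸ Q) + c
    offset with m≤n⇒m<n∨m≡n x≤M
    ... | inj₁ x<M = +-∸-comm c (x<M⇒Q≤R x<M)
    ... | inj₂ refl rewrite n∸n≡0 x = trans (cong (_∸ Q) (+-identityʳ R)) (sym (+-identityʳ _))

    quotient : divℕ (z ∸ A ∸ Q) D ≡ M ∸ x
    quotient = begin
        divℕ (z ∸ A ∸ Q) D   ≡⟨ cong (λ y → divℕ (y ∸ Q) D) minus-cube ⟩
        divℕ (R + c ∸ Q) D   ≡⟨ cong (λ y → divℕ y D) offset ⟩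
        divℕ (R ∸ Q + c) D   ≡⟨ divℕ-quotient (R ∸ Q) (M ∸ x) D
                                  (∸-below R (suc M ^ k) Q R<P (^-monoˡ-< k (n<1+n M))) ⟩
        M ∸ x                ∎
      where open ≡-Reasoning

    last-digit : M ∸ divℕ (z ∸ A ∸ Q) D ≡ x
    last-digit = trans (cong (M ∸_) quotient) (m∸[m∸n]≡n x≤M)

    remainder : z ∸ A ∸ (M ∸ (M ∸ divℕ (z ∸ A ∸ Q) D)) * D ≡ R
    remainder = begin
        z ∸ A ∸ (M ∸ (M ∸ divℕ (z ∸ A ∸ Q) D)) * D
      ≡⟨ cong (λ y → z ∸ A ∸ (M ∸ y) * D) last-digit ⟩
        z ∸ A ∸ c
      ≡⟨ cong (_∸ c) minus-cube ⟩
        R + c ∸ c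
      ≡⟨ m+n∸n≡m R c ⟩
        R
      ∎
      where open ≡-Reasoning

lemma16 : (n : ℕ) (xs : Vec ℕ (suc n)) → rinv n (r n xs) ≡ xs
lemma16 zero (x ∷ []) = refl
lemma16 (suc n) = by-∷ʳ (λ xs → rinv (suc n) (r (suc n) xs) ≡ xs) snoc
  where
  snoc : ∀ v x → rinv (suc n) (r (suc n) (v ∷ʳ x)) ≡ v ∷ʳ x
  snoc v x = begin
      rinv (suc n) (r (suc n) (v ∷ʳ x))
    ≡⟨ cong (rinv (suc n)) (r-∷ʳ n v x) ⟩
      rinv (suc n) (r n v + M ^ suc (suc n) + (M ∸ x) * shell (suc n) M)
    ≡⟨ decode-step n (r n v) M x (last≤maxV v x)
         (<-≤-trans (r-upper n v) (^-monoˡ-≤ (suc n) (s≤s (maxV-init≤ v x))))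
         maxInPrefix ⟩
      rinv n (r n v) ∷ʳ x
    ≡⟨ cong (_∷ʳ x) (lemma16 n v) ⟩
      v ∷ʳ x
    ∎
    where
      open ≡-Reasoning
      M = maxV (v ∷ʳ x)
      -- When x is not the maximum, M is the maximum of v, so r-lower applies.
      maxInPrefix : x < M → M ^ suc n ≤ r n v
      maxInPrefix x<M = subst (λ y → y ^ suc n ≤ r n v) (sym (maxV-in-init v x x<M)) (r-lower n v)
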